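{- Let $G$ be a connected loopless MP-digraph that is not a coherently oriented cycle. Then each dynamical module of $G$ is a sink, a source, or a linear graph with a single edge.
   Context: Digraphs: finite, at most one edge $(v,w)$ from $v$ to $w$ for distinct $v,w$. A coherently oriented cycle of length $n\ge2$ has distinct vertices $v_1,\dots,v_n$ and edges $(v_i,v_{i+1})$, $(v_n,v_1)$. An MP-digraph satisfies (MP1) no subgraph isomorphic to $D_A$ (vertices $v_0,v_1,v_2$, edges $(v_1,v_0),(v_0,v_2),(v_1,v_2)$) or $D_B$ (vertices $v_0,\dots,v_3$, edges $(v_0,v_1),(v_2,v_1),(v_2,v_3)$) or their edge-reversals, and (MP2) every coherently oriented cycle of length $\ge2$ is a connected component. For $G'\le G$: $C_G(G')$ is the subgraph spanned by $E(G)\setminus E(G')$; $\partial G'=V(G')\cap V(C_G(G'))$. A vertex is stable if its indegree or outdegree is $0$, unstable otherwise. A dynamical region is a connected subgraph $R$ with at least one edge such that (a) every vertex of $\partial R$ is unstable in $G$ but stable in $R$ and in $C_G(R)$, (b) no edge of $R$ lies on an oriented cycle of $G$ not contained in $R$; a dynamical module is a minimal dynamical region. A sink (resp. source) on $n+1$ vertices is a digraph with $n$ edges having a unique vertex $v$ such that every edge is incident to $v$ and has $v$ as target (resp. source). -}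

module Defs where

open import Data.Nat as ℕ using (ℕ; suc; s≤s)
open import Data.Fin using (Fin; zero; toℕ; fromℕ<)
open import Data.Bool using (Bool; T)
open import Data.Product using (Σ; ∃; ∃-syntax; _×_; _,_)
open import Data.Sum using (_⊎_)
open import Relation.Nullary using (¬_; yes; no)
open import Relation.Binary.PropositionalEquality using (_≡_; _≢_)
open import Function.Definitions using (Injective)

-- A finite digraph on the vertex set Fin n.  adj v w ≡ true means there
-- is an edge (v , w); hence there is at most one edge from v to w.
record Digraph : Set where
  field
    n   : ℕ
    adj : Fin n → Fin n → Bool
open Digraph public

Edge : (G : Digraph) → Fin (n G) → Fin (n G) → Set
Edge G v w = T (adj G v w)

Loopless : Digraph → Set
Loopless G = ∀ v → ¬ Edge G v v

ERel : Digraph → Set₁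
ERel G = Fin (n G) → Fin (n G) → Set

-- A subgraph is given by a vertex predicate and an edge
-- subset of E(G) whose endpoints lie in the vertex predicate.
-- A subgraph spanned by an edge set S has as vertices exactly the
-- endpoints of edges of S.

EdgeSet : Digraph → Set
EdgeSet G = Fin (n G) → Fin (n G) → Bool

InE : (G : Digraph) → EdgeSet G → ERel G
InE G S a b = T (S a b) × Edge G a b

IsEdgeSubset : (G : Digraph) → EdgeSet G → Set
IsEdgeSubset G S = ∀ a b → T (S a b) → Edge G a b

SpanV : (G : Digraph) → ERel G → Fin (n G) → Set
SpanV G R v = (∃[ w ] R v w) ⊎ (∃[ u ] R u v)

Compl : (G : Digraph) → EdgeSet G → ERel G
Compl G S a b = Edge G a b × ¬ T (S a b)

Boundary : (G : Digraph) → EdgeSet G → Fin (n G) → Set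
Boundary G S v = SpanV G (InE G S) v × SpanV G (Compl G S) v

data Walk {G : Digraph} (R : ERel G) : Fin (n G) → Fin (n G) → Set where
  here  : ∀ {v} → Walk R v v
  fwd   : ∀ {u v w : Fin (n G)} → R u v → Walk {G} R v w → Walk {G} R u w
  bwd   : ∀ {u v w : Fin (n G)} → R v u → Walk {G} R v w → Walk {G} R u w

ConnectedSub : (G : Digraph) → (Fin (n G) → Set) → ERel G → Set
ConnectedSub G V R = ∀ u v → V u → V v → Walk {G} R u v

Connected : Digraph → Set
Connected G = ∀ u v → Walk {G} (Edge G) u v

Unstable : (G : Digraph) → ERel G → Fin (n G) → Set
Unstable G R v = (∃[ u ] R u v) × (∃[ w ] R v w)

Stable : (G : Digraph) → ERel G → Fin (n G) → Set
Stable G R v = ¬ Unstable G R v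

-- Coherently oriented cycles of length k = suc (suc m) ≥ 2, given by an
-- injective enumeration c : Fin k → Fin n of their vertices, with edges
-- (c i , c (i+1 mod k)).

next : ∀ {m} → Fin (suc m) → Fin (suc m)
next {m} i with suc (toℕ i) ℕ.<? suc m
... | yes p = fromℕ< p
... | no _  = zero

record Cycle (G : Digraph) : Set where
  field
    m     : ℕ
    vert  : Fin (suc (suc m)) → Fin (n G)
    inj   : Injective _≡_ _≡_ vert
    edges : ∀ i → Edge G (vert i) (vert (next i))
open Cycle public

OnCycle : {G : Digraph} → Cycle G → Fin (n G) → Set
OnCycle c v = ∃[ i ] vert c i ≡ v

CycleEdge : {G : Digraph} → Cycle G → ERel G
CycleEdge c a b = ∃[ i ] (vert c i ≡ a × vert c (next i) ≡ b)

-- The subgraph (V , R) is a connected component of G: it is connected,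
-- and it is maximal, i.e. every edge of G incident to one of its
-- vertices belongs to it.
IsComponent : (G : Digraph) → (Fin (n G) → Set) → ERel G → Set
IsComponent G V R =
  ConnectedSub G V R ×
  (∀ a b → Edge G a b → (V a ⊎ V b) → R a b)

IsCycleGraph : Digraph → Set
IsCycleGraph G = Σ (Cycle G) λ c →
  (∀ v → OnCycle c v) × (∀ a b → Edge G a b → CycleEdge c a b)

HasDA : Digraph → Set
HasDA G = ∃[ v₀ ] ∃[ v₁ ] ∃[ v₂ ]
  (v₀ ≢ v₁ × v₀ ≢ v₂ × v₁ ≢ v₂) ×
  Edge G v₁ v₀ × Edge G v₀ v₂ × Edge G v₁ v₂

HasDAʳ : Digraph → Set
HasDAʳ G = ∃[ v₀ ] ∃[ v₁ ] ∃[ v₂ ]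
  (v₀ ≢ v₁ × v₀ ≢ v₂ × v₁ ≢ v₂) ×
  Edge G v₀ v₁ × Edge G v₂ v₀ × Edge G v₂ v₁

Distinct4 : ∀ {k} → Fin k → Fin k → Fin k → Fin k → Set
Distinct4 a b c d = a ≢ b × a ≢ c × a ≢ d × b ≢ c × b ≢ d × c ≢ d

HasDB : Digraph → Set
HasDB G = ∃[ v₀ ] ∃[ v₁ ] ∃[ v₂ ] ∃[ v₃ ]
  Distinct4 v₀ v₁ v₂ v₃ ×
  Edge G v₀ v₁ × Edge G v₂ v₁ × Edge G v₂ v₃

HasDBʳ : Digraph → Set
HasDBʳ G = ∃[ v₀ ] ∃[ v₁ ] ∃[ v₂ ] ∃[ v₃ ]
  Distinct4 v₀ v₁ v₂ v₃ ×
  Edge G v₁ v₀ × Edge G v₁ v₂ × Edge G v₃ v₂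

MP1 : Digraph → Set
MP1 G = ¬ HasDA G × ¬ HasDAʳ G × ¬ HasDB G × ¬ HasDBʳ G

MP2 : Digraph → Set
MP2 G = (c : Cycle G) → IsComponent G (OnCycle c) (CycleEdge c)

MPDigraph : Digraph → Set
MPDigraph G = MP1 G × MP2 G

-- A dynamical region is a connected
-- subgraph with at least one edge; such a subgraph has no isolated
-- vertices, so it is the subgraph spanned by its edge set S ⊆ E(G).

DynamicalRegion : (G : Digraph) → EdgeSet G → Set
DynamicalRegion G S =
  IsEdgeSubset G S ×
  ConnectedSub G (SpanV G (InE G S)) (InE G S) ×
  (∃[ a ] ∃[ b ] InE G S a b) ×
  (∀ v → Boundary G S v →
     Unstable G (Edge G) v × Stable G (InE G S) v × Stable G (Compl G S) v) ×
  (∀ a b → InE G S a b → (c : Cycle G) → CycleEdge c a b →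
     ∀ x y → CycleEdge c x y → InE G S x y)

DynamicalModule : (G : Digraph) → EdgeSet G → Set
DynamicalModule G S =
  DynamicalRegion G S ×
  (∀ S' → DynamicalRegion G S' →
     (∀ a b → InE G S' a b → InE G S a b) →
     (∀ a b → InE G S a b → InE G S' a b))

IsSink : (G : Digraph) → EdgeSet G → Set
IsSink G S = ∃[ v ]
  (∀ a b → InE G S a b → b ≡ v) ×
  (∀ w → (∀ a b → InE G S a b → b ≡ w) → w ≡ v)

IsSource : (G : Digraph) → EdgeSet G → Set
IsSource G S = ∃[ v ]
  (∀ a b → InE G S a b → a ≡ v) ×
  (∀ w → (∀ a b → InE G S a b → a ≡ w) → w ≡ v)

IsSingleEdge : (G : Digraph) → EdgeSet G → Set
IsSingleEdge G S = ∃[ a ] ∃[ b ]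
  InE G S a b × (∀ a' b' → InE G S a' b' → a' ≡ a × b' ≡ b)

-- MP2 makes every oriented cycle a connected component, hence all of the connected
-- graph G; so G has no oriented cycles and condition (b) is void.  Condition (a)
-- forbids a boundary vertex of a region R to have edges of R and of its complement on
-- the same side, so a region containing one out-edge (in-edge) of a vertex contains
-- all of them.  Fix an edge a → b of the module.  Excluding D_A, D_B and the reversal
-- of D_B shows that either a is the only in-neighbour of b and of every other
-- out-neighbour of a, or b is the only out-neighbour of a and of every other
-- in-neighbour of b.  In the first case the out-star of a is a dynamical region
-- contained in the module, so by minimality the module is that source; in the second
-- it is, dually, the in-star of b, a sink.  A single edge is both.
module Submission where

open import Defs
open import Data.Fin using (Fin; zero)
open import Data.Fin.Properties using (_≟_; any?)
open import Data.Product using (_×_; _,_; proj₁; proj₂)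
open import Data.Sum using (_⊎_; inj₁; inj₂; [_,_]′)
open import Data.Bool using (T)
open import Data.Empty using (⊥-elim)
open import Function using (_∘_)
open import Relation.Nullary using (¬_; yes; no)
open import Relation.Nullary.Decidable using (⌊_⌋; T?; ¬?; _×-dec_; toWitness; fromWitness; decidable-stable)
open import Relation.Binary.PropositionalEquality using (_≡_; _≢_; refl; sym; ≢-sym)

SoleInNeighbour SoleOutNeighbour : (G : Digraph) → Fin (n G) → Fin (n G) → Set
SoleInNeighbour  G a b = ∀ d → Edge G d b → d ≡ a
SoleOutNeighbour G a b = ∀ c → Edge G a c → c ≡ b

module _ {G : Digraph} where

  private
    Vertex : Set
    Vertex = Fin (n G)

  _◅◅_ : {R : ERel G} {u v w : Vertex} → Walk {G} R u v → Walk {G} R v w → Walk {G} R u w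
  here      ◅◅ q = q
  fwd e p ◅◅ q = fwd e (p ◅◅ q)
  bwd e p ◅◅ q = bwd e (p ◅◅ q)

  _⊆ᴱ_ : EdgeSet G → EdgeSet G → Set
  S ⊆ᴱ P = ∀ a b → InE G S a b → InE G P a b

  edge-endpoints-differ : Loopless G → {a b : Vertex} → Edge G a b → a ≢ b
  edge-endpoints-differ loopless {a} ab refl = loopless a ab

  cycle-covers : Connected G → MP2 G → (c : Cycle G) → ∀ v → OnCycle c v
  cycle-covers connected mp2 c v = along (zero , refl) (connected (vert c zero) v)
    where
      closed : ∀ a b → Edge G a b → OnCycle c a ⊎ OnCycle c b → CycleEdge c a b
      closed = proj₂ (mp2 c)

      along : ∀ {u w} → OnCycle c u → Walk {G} (Edge G) u w → OnCycle c w
      along on here = on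
      along {u} on (fwd {v = v} e p) with closed u v e (inj₁ on)
      ... | i , _ , eq = along (next i , eq) p
      along {u} on (bwd {v = v} e p) with closed v u e (inj₂ on)
      ... | i , eq , _ = along (i , eq) p

  cycle-free : Connected G → MP2 G → ¬ IsCycleGraph G → ¬ Cycle G
  cycle-free connected mp2 notCycle c = notCycle (c , covers , edges-on)
    where
      covers : ∀ v → OnCycle c v
      covers = cycle-covers connected mp2 c

      edges-on : ∀ a b → Edge G a b → CycleEdge c a b
      edges-on a b ab = proj₂ (mp2 c) a b ab (inj₁ (covers a))

  region-out-closed : ∀ {S a b c} → DynamicalRegion G S →
    InE G S a b → Edge G a c → InE G S a c
  region-out-closed {S} {a} {b} {c} (_ , _ , _ , boundary , _) ab ac with T? (S a c)
  ... | yes sac = sac , ac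
  ... | no ¬sac with boundary a (inj₁ (b , ab) , inj₁ (c , ac , ¬sac))
  ...   | ((u , ua) , _) , stableS , stableC with T? (S u a)
  ...     | yes sua = ⊥-elim (stableS ((u , sua , ua) , (b , ab)))
  ...     | no ¬sua = ⊥-elim (stableC ((u , ua , ¬sua) , (c , ac , ¬sac)))

  region-in-closed : ∀ {S a b d} → DynamicalRegion G S →
    InE G S a b → Edge G d b → InE G S d b
  region-in-closed {S} {a} {b} {d} (_ , _ , _ , boundary , _) ab db with T? (S d b)
  ... | yes sdb = sdb , db
  ... | no ¬sdb with boundary b (inj₂ (a , ab) , inj₂ (d , db , ¬sdb))
  ...   | (_ , (u , bu)) , stableS , stableC with T? (S b u)
  ...     | yes sbu = ⊥-elim (stableS ((a , ab) , (u , sbu , bu)))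
  ...     | no ¬sbu = ⊥-elim (stableC ((d , db , ¬sdb) , (u , bu , ¬sbu)))

  outStar inStar : Vertex → EdgeSet G
  outStar c x y = ⌊ (x ≟ c) ×-dec T? (adj G x y) ⌋
  inStar  c x y = ⌊ (y ≟ c) ×-dec T? (adj G x y) ⌋

  outStar-∋ : ∀ {c x y} → x ≡ c → Edge G x y → T (outStar c x y)
  outStar-∋ x≡c xy = fromWitness (x≡c , xy)

  inStar-∋ : ∀ {c x y} → y ≡ c → Edge G x y → T (inStar c x y)
  inStar-∋ y≡c xy = fromWitness (y≡c , xy)

  outStar-tail : ∀ {c x y} → T (outStar c x y) → x ≡ c
  outStar-tail = proj₁ ∘ toWitness

  inStar-head : ∀ {c x y} → T (inStar c x y) → y ≡ c
  inStar-head = proj₁ ∘ toWitness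

  outStar⊆region : ∀ {S c b} → DynamicalRegion G S → InE G S c b → outStar c ⊆ᴱ S
  outStar⊆region region cb x y (t , xy) with outStar-tail t
  ... | refl = region-out-closed region cb xy

  inStar⊆region : ∀ {S c a} → DynamicalRegion G S → InE G S a c → inStar c ⊆ᴱ S
  inStar⊆region region ac x y (t , xy) with inStar-head t
  ... | refl = region-in-closed region ac xy

  outStar-region⇒source : ∀ {S c b} → DynamicalModule G S → InE G S c b →
    DynamicalRegion G (outStar c) → IsSource G S
  outStar-region⇒source {S} {c} (region , minimal) cb starRegion =
    c , (λ x y → outStar-tail ∘ proj₁ ∘ S⊆star x y) , (λ _ tails → sym (tails _ _ cb))
    where
      S⊆star : S ⊆ᴱ outStar c
      S⊆star = minimal _ starRegion (outStar⊆region region cb)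

  inStar-region⇒sink : ∀ {S c a} → DynamicalModule G S → InE G S a c →
    DynamicalRegion G (inStar c) → IsSink G S
  inStar-region⇒sink {S} {c} (region , minimal) ac starRegion =
    c , (λ x y → inStar-head ∘ proj₁ ∘ S⊆star x y) , (λ _ heads → sym (heads _ _ ac))
    where
      S⊆star : S ⊆ᴱ inStar c
      S⊆star = minimal _ starRegion (inStar⊆region region ac)

  BoundaryCondition : EdgeSet G → Vertex → Set
  BoundaryCondition S v = Unstable G (Edge G) v × Stable G (InE G S) v × Stable G (Compl G S) v

  module _ (loopless : Loopless G) where

    private
      endpoints≢ : {a b : Vertex} → Edge G a b → a ≢ b
      endpoints≢ = edge-endpoints-differ loopless

    sole-in-neighbour-spreads : ¬ HasDA G → ¬ HasDB G → ∀ {a b c} →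
      Edge G a b → SoleInNeighbour G a b → Edge G a c → SoleInNeighbour G a c
    sole-in-neighbour-spreads noDA noDB {a} {b} {c} ab sole ac d dc with d ≟ a | c ≟ b | d ≟ b
    ... | yes d≡a | _        | _        = d≡a
    ... | no d≢a  | yes refl | _        = ⊥-elim (d≢a (sole d dc))
    ... | no _    | no c≢b   | yes refl =
      ⊥-elim (noDA (b , a , c , (≢-sym (endpoints≢ ab) , ≢-sym c≢b , endpoints≢ ac) , ab , dc , ac))
    ... | no d≢a  | no c≢b   | no d≢b   =
      ⊥-elim (noDB (d , c , a , b ,
        (endpoints≢ dc , d≢a , d≢b , ≢-sym (endpoints≢ ac) , c≢b , endpoints≢ ab) , dc , ac , ab))

    sole-out-neighbour-spreads : ¬ HasDA G → ¬ HasDBʳ G → ∀ {a b c} →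
      Edge G a b → SoleOutNeighbour G a b → Edge G c b → SoleOutNeighbour G c b
    sole-out-neighbour-spreads noDA noDBʳ {a} {b} {c} ab sole cb e ce with e ≟ b | c ≟ a | e ≟ a
    ... | yes e≡b | _        | _        = e≡b
    ... | no e≢b  | yes refl | _        = ⊥-elim (e≢b (sole e ce))
    ... | no _    | no c≢a   | yes refl =
      ⊥-elim (noDA (a , c , b , (≢-sym c≢a , endpoints≢ ab , endpoints≢ cb) , ce , ab , cb))
    ... | no e≢b  | no c≢a   | no e≢a   =
      ⊥-elim (noDBʳ (e , c , b , a ,
        (≢-sym (endpoints≢ ce) , e≢b , e≢a , endpoints≢ cb , c≢a , ≢-sym (endpoints≢ ab)) , ce , cb , ab))

    second-in-neighbour⇒sole-out-neighbour : ¬ HasDA G → ¬ HasDB G → ∀ {a b d} →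
      Edge G a b → Edge G d b → d ≢ a → SoleOutNeighbour G a b
    second-in-neighbour⇒sole-out-neighbour noDA noDB {a} {b} {d} ab db d≢a c ac with c ≟ b | d ≟ c
    ... | yes c≡b | _        = c≡b
    ... | no _    | yes refl =
      ⊥-elim (noDA (d , a , b , (≢-sym (endpoints≢ ac) , endpoints≢ db , endpoints≢ ab) , ac , db , ab))
    ... | no c≢b  | no d≢c   =
      ⊥-elim (noDB (d , b , a , c ,
        (endpoints≢ db , d≢a , d≢c , ≢-sym (endpoints≢ ab) , ≢-sym c≢b , endpoints≢ ac) , db , ab , ac))

    sole-in-or-sole-out-neighbour : ¬ HasDA G → ¬ HasDB G → ∀ {a b} →
      Edge G a b → SoleInNeighbour G a b ⊎ SoleOutNeighbour G a b
    sole-in-or-sole-out-neighbour noDA noDB {a} {b} ab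
      with any? (λ d → T? (adj G d b) ×-dec ¬? (d ≟ a))
    ... | yes (d , db , d≢a) = inj₂ (second-in-neighbour⇒sole-out-neighbour noDA noDB ab db d≢a)
    ... | no none            = inj₁ λ d db → decidable-stable (d ≟ a) (λ d≢a → none (d , db , d≢a))

    outStar-region : ¬ Cycle G → ∀ {c b} → Edge G c b →
      (∀ {y} → Edge G c y → SoleInNeighbour G c y) → DynamicalRegion G (outStar c)
    outStar-region acyclic {c} {b} cb leaves =
      (λ _ _ → proj₂ ∘ toWitness) , connected , (c , b , outStar-∋ refl cb , cb) ,
      boundary , λ _ _ _ cycle → ⊥-elim (acyclic cycle)
      where
        P : ERel G
        P = InE G (outStar c)

        toCentre : ∀ {u} → SpanV G P u → Walk {G} P u c
        toCentre (inj₁ (_ , t , _)) with outStar-tail t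
        ... | refl = here
        toCentre (inj₂ (_ , e@(t , _))) with outStar-tail t
        ... | refl = bwd e here

        fromCentre : ∀ {v} → SpanV G P v → Walk {G} P c v
        fromCentre (inj₁ (_ , t , _)) with outStar-tail t
        ... | refl = here
        fromCentre (inj₂ (_ , e@(t , _))) with outStar-tail t
        ... | refl = fwd e here

        connected : ConnectedSub G (SpanV G P) P
        connected _ _ u v = toCentre u ◅◅ fromCentre v

        centre : SpanV G (Compl G (outStar c)) c → BoundaryCondition (outStar c) c
        centre (inj₁ (_ , cw , ¬t)) = ⊥-elim (¬t (outStar-∋ refl cw))
        centre (inj₂ (u , uc , _)) =
          ((u , uc) , (b , cb)) ,
          (λ ((_ , t , xc) , _) → endpoints≢ xc (outStar-tail t)) ,
          (λ (_ , (_ , cw , ¬t)) → ¬t (outStar-∋ refl cw))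

        leaf : ∀ {y} → Edge G c y → SpanV G (Compl G (outStar c)) y →
          BoundaryCondition (outStar c) y
        leaf cy (inj₂ (u , uy , ¬t)) = ⊥-elim (¬t (outStar-∋ (leaves cy u uy) uy))
        leaf cy (inj₁ (w , yw , _)) =
          ((c , cy) , (w , yw)) ,
          (λ (_ , (_ , t , _)) → endpoints≢ cy (sym (outStar-tail t))) ,
          (λ ((u , uy , ¬t) , _) → ¬t (outStar-∋ (leaves cy u uy) uy))

        boundary : ∀ v → Boundary G (outStar c) v → BoundaryCondition (outStar c) v
        boundary v (inj₁ (_ , t , _) , other) with outStar-tail t
        ... | refl = centre other
        boundary v (inj₂ (_ , t , cv) , other) with outStar-tail t
        ... | refl = leaf cv other

    inStar-region : ¬ Cycle G → ∀ {a c} → Edge G a c →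
      (∀ {x} → Edge G x c → SoleOutNeighbour G x c) → DynamicalRegion G (inStar c)
    inStar-region acyclic {a} {c} ac leaves =
      (λ _ _ → proj₂ ∘ toWitness) , connected , (a , c , inStar-∋ refl ac , ac) ,
      boundary , λ _ _ _ cycle → ⊥-elim (acyclic cycle)
      where
        P : ERel G
        P = InE G (inStar c)

        toCentre : ∀ {u} → SpanV G P u → Walk {G} P u c
        toCentre (inj₁ (_ , e@(t , _))) with inStar-head t
        ... | refl = fwd e here
        toCentre (inj₂ (_ , t , _)) with inStar-head t
        ... | refl = here

        fromCentre : ∀ {v} → SpanV G P v → Walk {G} P c v
        fromCentre (inj₁ (_ , e@(t , _))) with inStar-head t
        ... | refl = bwd e here
        fromCentre (inj₂ (_ , t , _)) with inStar-head t
        ... | refl = here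

        connected : ConnectedSub G (SpanV G P) P
        connected _ _ u v = toCentre u ◅◅ fromCentre v

        centre : SpanV G (Compl G (inStar c)) c → BoundaryCondition (inStar c) c
        centre (inj₂ (_ , uc , ¬t)) = ⊥-elim (¬t (inStar-∋ refl uc))
        centre (inj₁ (w , cw , _)) =
          ((a , ac) , (w , cw)) ,
          (λ (_ , (_ , t , cy)) → endpoints≢ cy (sym (inStar-head t))) ,
          (λ ((_ , uc , ¬t) , _) → ¬t (inStar-∋ refl uc))

        leaf : ∀ {x} → Edge G x c → SpanV G (Compl G (inStar c)) x →
          BoundaryCondition (inStar c) x
        leaf xc (inj₁ (w , xw , ¬t)) = ⊥-elim (¬t (inStar-∋ (leaves xc w xw) xw))
        leaf xc (inj₂ (u , ux , _)) =
          ((u , ux) , (c , xc)) ,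
          (λ ((_ , t , _) , _) → endpoints≢ xc (inStar-head t)) ,
          (λ (_ , (w , xw , ¬t)) → ¬t (inStar-∋ (leaves xc w xw) xw))

        boundary : ∀ v → Boundary G (inStar c) v → BoundaryCondition (inStar c) v
        boundary v (inj₂ (_ , t , _) , other) with inStar-head t
        ... | refl = centre other
        boundary v (inj₁ (_ , t , xc) , other) with inStar-head t
        ... | refl = leaf xc other

corollary4p23 : (G : Digraph) → Connected G → Loopless G → MPDigraph G →
    ¬ IsCycleGraph G →
    (S : EdgeSet G) → DynamicalModule G S →
    IsSink G S ⊎ IsSource G S ⊎ IsSingleEdge G S
corollary4p23 G connected loopless ((noDA , _ , noDB , noDBʳ) , mp2) notCycle S
              dynModule@((_ , _ , (a , b , ab@(_ , a→b)) , _ , _) , _) =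
  [ inj₂ ∘ inj₁ ∘ source , inj₁ ∘ sink ]′ (sole-in-or-sole-out-neighbour loopless noDA noDB a→b)
  where
    acyclic : ¬ Cycle G
    acyclic = cycle-free connected mp2 notCycle

    source : SoleInNeighbour G a b → IsSource G S
    source soleIn = outStar-region⇒source dynModule ab
      (outStar-region loopless acyclic a→b (sole-in-neighbour-spreads loopless noDA noDB a→b soleIn))

    sink : SoleOutNeighbour G a b → IsSink G S
    sink soleOut = inStar-region⇒sink dynModule ab
      (inStar-region loopless acyclic a→b (sole-out-neighbour-spreads loopless noDA noDBʳ a→b soleOut))
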